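{- Let $T$ be a tree with vertex set $\{1,\ldots,n\}$ and edge set $\{e_1,\ldots,e_{n-1}\}$, edge $e_k$ having nonzero real weight $w_k$, and fix an orientation of the edges. Let $\Delta$ be the squared distance matrix of $T$, $Q$ the vertex-edge incidence matrix, $H$ the edge orientation matrix (both with respect to the fixed orientation), and $F=\mathrm{diag}(w_1,\ldots,w_{n-1})$. Then $Q'\Delta Q=-2FHF$.
   Context: For vertices $i\neq j$, $d(i,j)$ is the sum of the weights of the edges on the unique $ij$-path, $d(i,i)=0$, and $\Delta$ is the $n\times n$ matrix with $(i,j)$-entry $d(i,j)^2$. $Q$ is the $n\times(n-1)$ matrix whose $(i,k)$-entry is $1$ if $i$ is the initial vertex of $e_k$, $-1$ if $i$ is its terminal vertex, and $0$ otherwise. For oriented edges $e_i=(p,q)$ (from $p$ to $q$) and $e_j=(r,s)$, say $e_i$ and $e_j$ are similarly oriented if $\rho(p,r)=\rho(q,s)$, where $\rho$ denotes the (unweighted) path-length distance in the underlying tree, and oppositely oriented otherwise. $H$ is the $(n-1)\times(n-1)$ matrix with $(i,j)$-entry $1$ if $e_i,e_j$ are similarly oriented and $-1$ if they are oppositely oriented, with all diagonal entries equal to $1$. A prime denotes transpose. -}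

module Defs where

open import Level using (Level)
open import Data.Nat as ℕ using (ℕ; zero; suc)
open import Data.Fin as Fin using (Fin; zero; suc; _≟_)
open import Data.Product using (Σ; _×_; _,_; proj₁; proj₂)
open import Data.Sum using (_⊎_)
open import Data.List using (List; []; _∷_; length)
open import Data.List.Relation.Unary.Unique.Propositional using (Unique)
open import Relation.Binary.PropositionalEquality using (_≡_)
open import Relation.Nullary using (yes; no)
open import Algebra.Bundles using (CommutativeRing)

Ends : ℕ → ℕ → Set
Ends n m = Fin m → Fin n × Fin n

module _ {n m : ℕ} (ends : Ends n m) where

  init term : Fin m → Fin n
  init k = proj₁ (ends k)
  term k = proj₂ (ends k)

  Adj : Fin m → Fin n → Fin n → Set
  Adj k u v = (init k ≡ u × term k ≡ v) ⊎ (term k ≡ u × init k ≡ v)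

  data Walk : Fin n → Fin n → Set where
    []   : ∀ {u} → Walk u u
    step : ∀ {u v x} (k : Fin m) → Adj k u v → Walk v x → Walk u x

  vertices : ∀ {u v} → Walk u v → List (Fin n)
  vertices {u} []            = u ∷ []
  vertices {u} (step k _ p)  = u ∷ vertices p

  edges : ∀ {u v} → Walk u v → List (Fin m)
  edges []           = []
  edges (step k _ p) = k ∷ edges p

  IsPath : ∀ {u v} → Walk u v → Set
  IsPath p = Unique (vertices p)

  record IsTree : Set where
    field
      path      : ∀ u v → Walk u v
      path-ok   : ∀ u v → IsPath (path u v)
      path-uniq : ∀ u v (p q : Walk u v) → IsPath p → IsPath q → edges p ≡ edges q

  module _ (T : IsTree) where
    open IsTree T

    ρ : Fin n → Fin n → ℕ
    ρ u v = length (edges (path u v))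

module Matrices {c ℓ : Level} (R : CommutativeRing c ℓ) where
  open CommutativeRing R hiding (zero)

  Matrix : ℕ → ℕ → Set c
  Matrix a b = Fin a → Fin b → Carrier

  ∑ : ∀ {k} → (Fin k → Carrier) → Carrier
  ∑ {ℕ.zero}  f = 0#
  ∑ {suc k} f = f Fin.zero + ∑ (λ i → f (suc i))

  _ᵀ : ∀ {a b} → Matrix a b → Matrix b a
  (A ᵀ) i j = A j i

  infixl 7 _·_
  _·_ : ∀ {a b d} → Matrix a b → Matrix b d → Matrix a d
  (A · B) i j = ∑ (λ k → A i k * B k j)

  diag : ∀ {a} → (Fin a → Carrier) → Matrix a a
  diag v i j with i ≟ j
  ... | yes _ = v i
  ... | no  _ = 0#

  scale : ∀ {a b} → Carrier → Matrix a b → Matrix a b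
  scale x A i j = x * A i j

  sumList : ∀ {m} → (Fin m → Carrier) → List (Fin m) → Carrier
  sumList w []       = 0#
  sumList w (k ∷ ks) = w k + sumList w ks

  module _ {n m : ℕ} (ends : Ends n m) (T : IsTree ends) (w : Fin m → Carrier) where
    open IsTree T

    dist : Fin n → Fin n → Carrier
    dist i j = sumList w (edges ends (path i j))

    Δ : Matrix n n
    Δ i j = dist i j * dist i j

    Q : Matrix n m
    Q i k with i ≟ init ends k
    ... | yes _ = 1#
    ... | no  _ with i ≟ term ends k
    ...   | yes _ = - 1#
    ...   | no  _ = 0#

    H : Matrix m m
    H k l with k ≟ l
    ... | yes _ = 1#
    ... | no  _ with ρ ends T (init ends k) (init ends l) ℕ.≟ ρ ends T (term ends k) (term ends l)
    ...   | yes _ = 1#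
    ...   | no  _ = - 1#

    F : Matrix m m
    F = diag w

{-# OPTIONS --safe #-}

-- Column k of Q is the indicator of the tail p minus that of the head q of e_k, so for
-- e_k = (p,q) and e_l = (r,s) the (k,l) entry of Q′ΔQ is the mixed difference
-- d(p,r)² − d(q,r)² − d(p,s)² + d(q,s)².  Removing e_k splits the tree in two, and a vertex
-- x on the side of q has d(p,x) = w_k + d(q,x) (symmetrically on the side of p); for l ≠ k
-- both ends of e_l lie on the same side.  So the four distances are x, w_k + x, w_l + x and
-- w_k + w_l + x, and the entry is 2w_k w_l when d(p,r) or d(q,s) is the largest of them,
-- which is exactly when ρ(p,r) and ρ(q,s) differ (by 2), and −2w_k w_l otherwise.  On the
-- diagonal the entry is −2w_k².

module Submission where

open import Defs
open import Level using (Level)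
open import Function using (_∘_)
open import Function.Definitions using (Injective)
open import Data.Empty using (⊥)
open import Data.Nat as ℕ using (ℕ; suc)
open import Data.Nat.Properties using (n<1+n; >⇒≢; m<n⇒m<1+n)
open import Data.Fin as Fin using (Fin; zero; suc; punchIn; punchOut)
open import Data.Fin.Properties
  using (suc-injective; punchOut-injective; <⇒notInjective; punchInᵢ≢i; punchIn-injective; punchIn-punchOut)
open import Data.Product using (Σ-syntax; _×_; _,_; proj₁; proj₂)
open import Data.Sum as Sum using (_⊎_; inj₁; inj₂)
open import Data.Vec.Functional using (replicate)
open import Data.List using (List; []; _∷_; _++_; reverse; length; [_]; foldr; map)
open import Data.List.Properties using (unfold-reverse; ∷-injective; ∷ʳ-injectiveʳ; length-reverse; reverse-map)
open import Data.List.Membership.Propositional using (_∈_; _∉_)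
open import Data.List.Membership.Propositional.Properties using (∈-++⁻)
import Data.List.Membership.DecPropositional as DecMembership
open import Data.List.Relation.Binary.Subset.Propositional using (_⊆_)
open import Data.List.Relation.Unary.Any using (here; there)
open import Data.List.Relation.Unary.All as All using ([]; _∷_)
open import Data.List.Relation.Unary.All.Properties using (¬Any⇒All¬)
open import Data.List.Relation.Unary.AllPairs using ([]; _∷_)
open import Data.List.Relation.Unary.Unique.Propositional using (Unique)
open import Data.List.Relation.Unary.Unique.Propositional.Properties using (++⁺)
import Data.List.Relation.Binary.Permutation.Setoid as Permutation
import Data.List.Relation.Binary.Permutation.Setoid.Properties as Permutation-Properties
open import Relation.Nullary using (¬_; Dec; yes; no; contradiction)
open import Relation.Binary.PropositionalEquality as ≡ using (_≡_; _≢_; ≡-≟-identity; ≢-≟-identity)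
open import Algebra.Bundles using (CommutativeRing)

injective-onto : ∀ {m} {f : Fin m → Fin m} → Injective _≡_ _≡_ f → ∀ k → ¬ (∀ j → f j ≢ k)
injective-onto {suc m} {f} f-inj k misses = <⇒notInjective (n<1+n m) g-inj
  where
  avoids : ∀ j → k ≢ f j
  avoids j = misses j ∘ ≡.sym
  g : Fin (suc m) → Fin m
  g j = punchOut (avoids j)
  g-inj : Injective _≡_ _≡_ g
  g-inj = f-inj ∘ punchOut-injective (avoids _) (avoids _)

≡2+⇒≢ : ∀ {x y} → x ≡ suc (suc y) → x ≢ y
≡2+⇒≢ {y = y} x≡2+y x≡y = >⇒≢ (m<n⇒m<1+n (n<1+n y)) (≡.trans (≡.sym x≡2+y) x≡y)

module Walks {n m : ℕ} (ends : Ends n m) where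
  open ≡ hiding ([_])

  Adj-sym : ∀ {k u v} → Adj ends k u v → Adj ends k v u
  Adj-sym (inj₁ (a , b)) = inj₂ (b , a)
  Adj-sym (inj₂ (a , b)) = inj₁ (b , a)

  Adj-functional : ∀ {k u v v′} → Adj ends k u v → Adj ends k u v′ → v ≡ v′
  Adj-functional (inj₁ (a , b)) (inj₁ (c , d)) = trans (sym b) d
  Adj-functional (inj₁ (a , b)) (inj₂ (c , d)) = trans (sym b) (trans c (trans (sym a) d))
  Adj-functional (inj₂ (a , b)) (inj₁ (c , d)) = trans (sym b) (trans c (trans (sym a) d))
  Adj-functional (inj₂ (a , b)) (inj₂ (c , d)) = trans (sym b) d

  Adj-crossed : ∀ {k u v u′ v′} → Adj ends k u v → Adj ends k u′ v′ → u ≢ u′ → v ≡ u′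
  Adj-crossed (inj₁ (a , b)) (inj₁ (c , d)) u≢u′ = contradiction (trans (sym a) c) u≢u′
  Adj-crossed (inj₁ (a , b)) (inj₂ (c , d)) u≢u′ = trans (sym b) c
  Adj-crossed (inj₂ (a , b)) (inj₁ (c , d)) u≢u′ = trans (sym b) c
  Adj-crossed (inj₂ (a , b)) (inj₂ (c , d)) u≢u′ = contradiction (trans (sym a) c) u≢u′

  Adj-loop : ∀ {k u v} → init ends k ≡ term ends k → Adj ends k u v → u ≡ v
  Adj-loop loop (inj₁ (a , b)) = trans (sym a) (trans loop b)
  Adj-loop loop (inj₂ (a , b)) = trans (sym a) (trans (sym loop) b)

  _∷ʳʷ_ : ∀ {u v x} → Walk ends u v → Σ[ k ∈ Fin m ] Adj ends k v x → Walk ends u x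
  []           ∷ʳʷ (k , a) = step k a []
  step l b P   ∷ʳʷ e       = step l b (P ∷ʳʷ e)

  vertices-∷ʳʷ : ∀ {u v x} (P : Walk ends u v) (e : Σ[ k ∈ Fin m ] Adj ends k v x) →
                 vertices ends (P ∷ʳʷ e) ≡ vertices ends P ++ [ x ]
  vertices-∷ʳʷ []           e = refl
  vertices-∷ʳʷ (step l b P) e = cong (_ ∷_) (vertices-∷ʳʷ P e)

  edges-∷ʳʷ : ∀ {u v x} (P : Walk ends u v) (k : Fin m) (a : Adj ends k v x) →
              edges ends (P ∷ʳʷ (k , a)) ≡ edges ends P ++ [ k ]
  edges-∷ʳʷ []           k a = refl
  edges-∷ʳʷ (step l b P) k a = cong (l ∷_) (edges-∷ʳʷ P k a)

  reverseʷ : ∀ {u v} → Walk ends u v → Walk ends v u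
  reverseʷ []           = []
  reverseʷ (step k a P) = reverseʷ P ∷ʳʷ (k , Adj-sym a)

  vertices-reverseʷ : ∀ {u v} (P : Walk ends u v) → vertices ends (reverseʷ P) ≡ reverse (vertices ends P)
  vertices-reverseʷ []               = refl
  vertices-reverseʷ {u} (step k a P) = begin
    vertices ends (reverseʷ P ∷ʳʷ (k , Adj-sym a)) ≡⟨ vertices-∷ʳʷ (reverseʷ P) _ ⟩
    vertices ends (reverseʷ P) ++ [ u ]           ≡⟨ cong (_++ [ u ]) (vertices-reverseʷ P) ⟩
    reverse (vertices ends P) ++ [ u ]            ≡⟨ unfold-reverse u (vertices ends P) ⟨
    reverse (u ∷ vertices ends P)                 ∎
    where open ≡-Reasoning

  edges-reverseʷ : ∀ {u v} (P : Walk ends u v) → edges ends (reverseʷ P) ≡ reverse (edges ends P)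
  edges-reverseʷ []           = refl
  edges-reverseʷ (step k a P) = begin
    edges ends (reverseʷ P ∷ʳʷ (k , Adj-sym a)) ≡⟨ edges-∷ʳʷ (reverseʷ P) k (Adj-sym a) ⟩
    edges ends (reverseʷ P) ++ [ k ]           ≡⟨ cong (_++ [ k ]) (edges-reverseʷ P) ⟩
    reverse (edges ends P) ++ [ k ]            ≡⟨ unfold-reverse k (edges ends P) ⟨
    reverse (k ∷ edges ends P)                 ∎
    where open ≡-Reasoning

  IsPath-reverseʷ : ∀ {u v} {P : Walk ends u v} → IsPath ends P → IsPath ends (reverseʷ P)
  IsPath-reverseʷ {P = P} uP = subst Unique (sym (vertices-reverseʷ P))
    (Unique-resp-↭ (↭-sym (↭-reverse (vertices ends P))) uP)
    where open Permutation (setoid (Fin n)) using (↭-sym)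
          open Permutation-Properties (setoid (Fin n)) using (Unique-resp-↭; ↭-reverse)

  vertices-determined : ∀ {u v} (P P′ : Walk ends u v) → edges ends P ≡ edges ends P′ →
                        vertices ends P ≡ vertices ends P′
  vertices-determined []           []             _  = refl
  vertices-determined (step k a P) (step k′ b P′) eq with refl , eq′ ← ∷-injective eq
                                                     with refl ← Adj-functional a b
    = cong (_ ∷_) (vertices-determined P P′ eq′)

  prefix : ∀ {u x s} (P : Walk ends u x) → IsPath ends P → s ∈ vertices ends P →
           Σ[ S ∈ Walk ends u s ] IsPath ends S × vertices ends S ⊆ vertices ends P
  prefix []           _        (here refl) = [] , [] ∷ [] , λ z∈ → z∈
  prefix (step k a P) _        (here refl) = [] , [] ∷ [] , λ { (here refl) → here refl }
  prefix (step k a P) (h ∷ uP) (there s∈)  with S , uS , S⊆P ← prefix P uP s∈ =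
    step k a S , All.tabulate (All.lookup h ∘ S⊆P) ∷ uS ,
    λ { (here refl) → here refl ; (there z∈) → there (S⊆P z∈) }

  suffix : ∀ {u x p} (P : Walk ends u x) → IsPath ends P → p ∈ vertices ends P →
           Σ[ S ∈ Walk ends p x ] IsPath ends S × vertices ends S ⊆ vertices ends P
  suffix []           uP       (here refl) = [] , uP , λ z∈ → z∈
  suffix (step k a P) uP       (here refl) = step k a P , uP , λ z∈ → z∈
  suffix (step k a P) (h ∷ uP) (there p∈)  with S , uS , S⊆P ← suffix P uP p∈ =
    S , uS , there ∘ S⊆P

  proper-suffix : ∀ {q x p} (P : Walk ends q x) → IsPath ends P → p ∈ vertices ends P → p ≢ q →
                  Σ[ S ∈ Walk ends p x ] IsPath ends S × q ∉ vertices ends S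
  proper-suffix []           _        (here refl) p≢q = contradiction refl p≢q
  proper-suffix (step k a P) _        (here refl) p≢q = contradiction refl p≢q
  proper-suffix (step k a P) (h ∷ uP) (there p∈)  _   with S , uS , S⊆P ← suffix P uP p∈ =
    S , uS , λ q∈ → All.lookup h (S⊆P q∈) refl

  IsPath-∷ʳʷ : ∀ {u v x} {P : Walk ends u v} (e : Σ[ k ∈ Fin m ] Adj ends k v x) →
               IsPath ends P → x ∉ vertices ends P → IsPath ends (P ∷ʳʷ e)
  IsPath-∷ʳʷ {P = P} e uP x∉ = subst Unique (sym (vertices-∷ʳʷ P e))
    (++⁺ uP ([] ∷ []) λ { (x∈ , here refl) → x∉ x∈ })

module Trees {n m : ℕ} (ends : Ends n m) (T : IsTree ends) where
  open IsTree T
  open Walks ends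
  open ≡ hiding ([_])
  open DecMembership (Fin._≟_ {n}) using (_∈?_)

  pathEdges : Fin n → Fin n → List (Fin m)
  pathEdges u v = edges ends (path u v)

  pathEdges-unique : ∀ {u v} (P : Walk ends u v) → IsPath ends P → edges ends P ≡ pathEdges u v
  pathEdges-unique P uP = path-uniq _ _ P (path _ _) uP (path-ok _ _)

  pathVertices-unique : ∀ {u v} (P : Walk ends u v) → IsPath ends P → vertices ends P ≡ vertices ends (path u v)
  pathVertices-unique P uP = vertices-determined P (path _ _) (pathEdges-unique P uP)

  pathEdges-refl : ∀ u → pathEdges u u ≡ []
  pathEdges-refl u = sym (pathEdges-unique [] ([] ∷ []))

  pathEdges-sym : ∀ u v → pathEdges v u ≡ reverse (pathEdges u v)
  pathEdges-sym u v = begin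
    pathEdges v u                   ≡⟨ pathEdges-unique (reverseʷ (path u v)) (IsPath-reverseʷ (path-ok u v)) ⟨
    edges ends (reverseʷ (path u v)) ≡⟨ edges-reverseʷ (path u v) ⟩
    reverse (pathEdges u v)         ∎
    where open ≡-Reasoning

  ρ-sym : ∀ u v → ρ ends T v u ≡ ρ ends T u v
  ρ-sym u v = trans (cong length (pathEdges-sym u v)) (length-reverse (pathEdges u v))

  pathEdges-edge : ∀ {k p q} → Adj ends k p q → p ≢ q → pathEdges p q ≡ [ k ]
  pathEdges-edge {k} a p≢q = sym (pathEdges-unique (step k a []) ((p≢q ∷ []) ∷ [] ∷ []))

  FirstStep : Fin n → Fin n → Set
  FirstStep u v = Σ[ k ∈ Fin m ] Σ[ x ∈ Fin n ] Adj ends k u x × u ≢ x × pathEdges u v ≡ k ∷ pathEdges x v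

  path-first-step : ∀ {u v} → u ≢ v → FirstStep u v
  path-first-step {u} {v} u≢v with path u v | path-ok u v
  ... | []         | _        = contradiction refl u≢v
  ... | step k a P | u∉P ∷ uP = k , _ , a , All.lookup u∉P (head∈ P) , cong (k ∷_) (pathEdges-unique P uP)
    where
    head∈ : ∀ {x y} (P : Walk ends x y) → x ∈ vertices ends P
    head∈ []           = here refl
    head∈ (step _ _ _) = here refl

  first-edge-injective : ∀ {u u′ v} (f : FirstStep u v) (f′ : FirstStep u′ v) →
                         proj₁ f ≡ proj₁ f′ → u ≡ u′
  first-edge-injective {u} {u′} (k , _ , a , _ , e) (k , _ , b , _ , e′) refl with u Fin.≟ u′
  ... | yes u≡u′ = u≡u′
  ... | no u≢u′ with refl ← Adj-crossed a b u≢u′ | refl ← Adj-crossed b a (u≢u′ ∘ sym) =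
    contradiction refl (≡2+⇒≢ (cong length (trans e (cong (k ∷_) e′))))

  Crosses : Fin m → Fin n → Fin n → Fin n → Set
  Crosses k u v x = pathEdges u x ≡ k ∷ pathEdges v x

  Avoids : Fin n → Fin n → Fin n → Set
  Avoids p q x = p ∉ vertices ends (path q x)

  avoidance-side : ∀ {k p q} → Adj ends k p q → p ≢ q → ∀ x →
    (Avoids p q x × Crosses k p q x) ⊎ (¬ Avoids p q x × Crosses k q p x)
  avoidance-side {k} {p} {q} a p≢q x with p ∈? vertices ends (path q x)
  ... | no p∉ = inj₁ (p∉ , sym (pathEdges-unique (step k a (path q x)) (¬Any⇒All¬ _ p∉ ∷ path-ok q x)))
  ... | yes p∈ with S , uS , q∉S ← proper-suffix (path q x) (path-ok q x) p∈ p≢q =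
    inj₂ (contradiction p∈ , (begin
      pathEdges q x                     ≡⟨ pathEdges-unique (step k (Adj-sym a) S) (¬Any⇒All¬ _ q∉S ∷ uS) ⟨
      k ∷ edges ends S                  ≡⟨ cong (k ∷_) (pathEdges-unique S uS) ⟩
      k ∷ pathEdges p x                 ∎))
    where open ≡-Reasoning

  Avoids-across : ∀ {k l p q r s} → Adj ends k p q → Adj ends l r s → p ≢ q → k ≢ l →
                  Avoids p q r → Avoids p q s
  Avoids-across {k} {l} {p} {q} {r} {s} a b p≢q k≢l p∉ p∈ with s ∈? vertices ends (path q r)
  ... | yes s∈ with S , uS , S⊆P ← prefix (path q r) (path-ok q r) s∈ =
    p∉ (S⊆P (subst (p ∈_) (sym (pathVertices-unique S uS)) p∈))
  ... | no s∉ = p∉extension (∈-++⁻ (vertices ends P) (subst (p ∈_) extension-vertices p∈))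
    where
    P = path q r
    W = P ∷ʳʷ (l , b)
    uW : IsPath ends W
    uW = IsPath-∷ʳʷ (l , b) (path-ok q r) s∉
    extension-vertices : vertices ends (path q s) ≡ vertices ends P ++ [ s ]
    extension-vertices = trans (sym (pathVertices-unique W uW)) (vertices-∷ʳʷ P (l , b))
    open ≡-Reasoning
    p∉extension : p ∈ vertices ends P ⊎ p ∈ [ s ] → ⊥
    p∉extension (inj₁ p∈P)         = p∉ p∈P
    p∉extension (inj₂ (here refl)) = k≢l (sym (∷ʳ-injectiveʳ (edges ends P) [] (begin
      edges ends P ++ [ l ]  ≡⟨ edges-∷ʳʷ P l b ⟨
      edges ends W           ≡⟨ pathEdges-unique W uW ⟩
      pathEdges q p          ≡⟨ pathEdges-edge (Adj-sym a) (p≢q ∘ sym) ⟩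
      [ k ]                  ∎)))

  edge-side : ∀ {k p q} → Adj ends k p q → p ≢ q → ∀ x → Crosses k p q x ⊎ Crosses k q p x
  edge-side a p≢q x = Sum.map proj₂ proj₂ (avoidance-side a p≢q x)

  same-side : ∀ {k l p q r s} → Adj ends k p q → Adj ends l r s → p ≢ q → k ≢ l →
              (Crosses k p q r × Crosses k p q s) ⊎ (Crosses k q p r × Crosses k q p s)
  same-side {r = r} {s} a b p≢q k≢l with avoidance-side a p≢q r | avoidance-side a p≢q s
  ... | inj₁ (_ , kr)     | inj₁ (_ , ks)     = inj₁ (kr , ks)
  ... | inj₂ (_ , kr)     | inj₂ (_ , ks)     = inj₂ (kr , ks)
  ... | inj₁ (avoids , _) | inj₂ (¬avoids , _) = contradiction (Avoids-across a b p≢q k≢l avoids) ¬avoids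
  ... | inj₂ (¬avoids , _) | inj₁ (avoids , _) = contradiction (Avoids-across a (Adj-sym b) p≢q k≢l avoids) ¬avoids

module LoopFree {m : ℕ} (ends : Ends (suc m) m) (T : IsTree ends) where
  open Walks ends
  open Trees ends T
  open ≡ using (_≡_; sym; subst)

  toRoot : ∀ j → FirstStep (suc j) zero
  toRoot j = path-first-step λ ()

  parent : Fin m → Fin m
  parent j = proj₁ (toRoot j)

  parent-injective : Injective _≡_ _≡_ parent
  parent-injective same = suc-injective (first-edge-injective (toRoot _) (toRoot _) same)

  -- Sending each non-root vertex to the first edge of its path to the root is injective,
  -- hence onto, and a first edge joins distinct vertices.
  init≢term : ∀ k → init ends k ≢ term ends k
  init≢term k loop = injective-onto parent-injective k parent≢k
    where
    parent≢k : ∀ j → parent j ≢ k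
    parent≢k j parent≡k with _ , _ , a , j≢x , _ ← toRoot j =
      j≢x (Adj-loop (subst (λ k′ → init ends k′ ≡ term ends k′) (sym parent≡k) loop) a)

module MixedDifference {c ℓ : Level} (R : CommutativeRing c ℓ) where
  open CommutativeRing R
  open import Algebra.Properties.AbelianGroup +-abelianGroup using (⁻¹-anti-homo‿-; ⁻¹-∙-comm; //-rightDividesʳ)
  open import Algebra.Properties.CommutativeSemigroup +-commutativeSemigroup using (interchange)
  open import Algebra.Solver.Ring.NaturalCoefficients.Default commutativeSemiring using (solve; _:+_; _:*_; _:=_)
  open import Relation.Binary.Reasoning.Setoid setoid

  mixedΔ : Carrier → Carrier → Carrier → Carrier → Carrier
  mixedΔ a b c d = (a * a - b * b) - (c * c - d * d)

  mixedΔ-regroup : ∀ a b c d → mixedΔ a b c d ≈ (a * a + d * d) - (b * b + c * c)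
  mixedΔ-regroup a b c d = begin
    (a * a - b * b) + - (c * c - d * d)    ≈⟨ +-congˡ (⁻¹-anti-homo‿- (c * c) (d * d)) ⟩
    (a * a - b * b) + (d * d - c * c)      ≈⟨ interchange (a * a) (- (b * b)) (d * d) (- (c * c)) ⟩
    (a * a + d * d) + (- (b * b) - c * c)  ≈⟨ +-congˡ (⁻¹-∙-comm (b * b) (c * c)) ⟩
    (a * a + d * d) - (b * b + c * c)      ∎

  mixedΔ-balanced : ∀ {a b c d} t → a * a + d * d ≈ t + (b * b + c * c) → mixedΔ a b c d ≈ t
  mixedΔ-balanced {a} {b} {c} {d} t eq = begin
    mixedΔ a b c d                           ≈⟨ mixedΔ-regroup a b c d ⟩
    (a * a + d * d) - (b * b + c * c)        ≈⟨ +-congʳ eq ⟩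
    (t + (b * b + c * c)) - (b * b + c * c)  ≈⟨ //-rightDividesʳ _ t ⟩
    t                                        ∎

  mixedΔ-balanced⁻ : ∀ {a b c d} t → b * b + c * c ≈ t + (a * a + d * d) → mixedΔ a b c d ≈ - t
  mixedΔ-balanced⁻ {a} {b} {c} {d} t eq = begin
    mixedΔ a b c d                           ≈⟨ mixedΔ-regroup a b c d ⟩
    (a * a + d * d) - (b * b + c * c)        ≈⟨ +-congˡ (-‿cong eq) ⟩
    (a * a + d * d) - (t + (a * a + d * d))  ≈⟨ ⁻¹-anti-homo‿- (t + (a * a + d * d)) (a * a + d * d) ⟨
    - ((t + (a * a + d * d)) - (a * a + d * d)) ≈⟨ -‿cong (//-rightDividesʳ _ t) ⟩
    - t                                      ∎

  parallelogram : ∀ w v x → x * x + (w + (v + x)) * (w + (v + x)) ≈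
                            (w * v + w * v) + ((w + x) * (w + x) + (v + x) * (v + x))
  parallelogram = solve 3 (λ w v x → x :* x :+ (w :+ (v :+ x)) :* (w :+ (v :+ x)) :=
                                     (w :* v :+ w :* v) :+ ((w :+ x) :* (w :+ x) :+ (v :+ x) :* (v :+ x))) refl

  squares-cong : ∀ {a a′ b b′} → a ≈ a′ → b ≈ b′ → a * a + b * b ≈ a′ * a′ + b′ * b′
  squares-cong a≈ b≈ = +-cong (*-cong a≈ a≈) (*-cong b≈ b≈)

  -- In the mixedΔ-far-… lemmas the four arguments are x, w + x, v + x and w + (v + x) in
  -- some order; the suffix names the largest.
  mixedΔ-far-a : ∀ {a b c d} w v → a ≈ w + b → b ≈ v + d → c ≈ w + d → mixedΔ a b c d ≈ w * v + w * v
  mixedΔ-far-a {a} {b} {c} {d} w v a≈ b≈ c≈ = mixedΔ-balanced _ (begin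
    a * a + d * d                                ≈⟨ +-comm _ _ ⟩
    d * d + a * a                                ≈⟨ squares-cong refl (trans a≈ (+-congˡ b≈)) ⟩
    d * d + (w + (v + d)) * (w + (v + d))        ≈⟨ parallelogram w v d ⟩
    (w * v + w * v) + ((w + d) * (w + d) + (v + d) * (v + d)) ≈⟨ +-congˡ (+-comm _ _) ⟩
    (w * v + w * v) + ((v + d) * (v + d) + (w + d) * (w + d)) ≈⟨ +-congˡ (squares-cong b≈ c≈) ⟨
    (w * v + w * v) + (b * b + c * c)            ∎)

  mixedΔ-far-b : ∀ {a b c d} w v → b ≈ w + a → a ≈ v + c → d ≈ w + c → mixedΔ a b c d ≈ - (w * v + w * v)
  mixedΔ-far-b {a} {b} {c} {d} w v b≈ a≈ d≈ = mixedΔ-balanced⁻ _ (begin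
    b * b + c * c                                ≈⟨ +-comm _ _ ⟩
    c * c + b * b                                ≈⟨ squares-cong refl (trans b≈ (+-congˡ a≈)) ⟩
    c * c + (w + (v + c)) * (w + (v + c))        ≈⟨ parallelogram w v c ⟩
    (w * v + w * v) + ((w + c) * (w + c) + (v + c) * (v + c)) ≈⟨ +-congˡ (+-comm _ _) ⟩
    (w * v + w * v) + ((v + c) * (v + c) + (w + c) * (w + c)) ≈⟨ +-congˡ (squares-cong a≈ d≈) ⟨
    (w * v + w * v) + (a * a + d * d)            ∎)

  mixedΔ-reverse : ∀ a b c d → mixedΔ d c b a ≈ mixedΔ a b c d
  mixedΔ-reverse a b c d = begin
    mixedΔ d c b a                     ≈⟨ mixedΔ-regroup d c b a ⟩
    (d * d + a * a) - (c * c + b * b)  ≈⟨ +-cong (+-comm _ _) (-‿cong (+-comm _ _)) ⟩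
    (a * a + d * d) - (b * b + c * c)  ≈⟨ mixedΔ-regroup a b c d ⟨
    mixedΔ a b c d                     ∎

  mixedΔ-far-c : ∀ {a b c d} w v → c ≈ w + d → d ≈ v + b → a ≈ w + b → mixedΔ a b c d ≈ - (w * v + w * v)
  mixedΔ-far-c {a} {b} {c} {d} w v c≈ d≈ a≈ = trans (mixedΔ-reverse d c b a) (mixedΔ-far-b w v c≈ d≈ a≈)

  mixedΔ-far-d : ∀ {a b c d} w v → d ≈ w + c → c ≈ v + a → b ≈ w + a → mixedΔ a b c d ≈ w * v + w * v
  mixedΔ-far-d {a} {b} {c} {d} w v d≈ c≈ b≈ = trans (mixedΔ-reverse d c b a) (mixedΔ-far-a w v d≈ c≈ b≈)

  mixedΔ-diagonal : ∀ {a b c d} w → a ≈ 0# → b ≈ w → c ≈ w → d ≈ 0# → mixedΔ a b c d ≈ - (w * w + w * w)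
  mixedΔ-diagonal {a} {b} {c} {d} w a≈ b≈ c≈ d≈ = mixedΔ-balanced⁻ _ (begin
    b * b + c * c                  ≈⟨ squares-cong b≈ c≈ ⟩
    w * w + w * w                  ≈⟨ +-identityʳ _ ⟨
    (w * w + w * w) + 0#           ≈⟨ +-congˡ (trans (+-cong (zeroˡ 0#) (zeroˡ 0#)) (+-identityʳ 0#)) ⟨
    (w * w + w * w) + (0# * 0# + 0# * 0#) ≈⟨ +-congˡ (squares-cong a≈ d≈) ⟨
    (w * w + w * w) + (a * a + d * d) ∎)

module FinSums {c ℓ : Level} (R : CommutativeRing c ℓ) where
  open CommutativeRing R hiding (zero)
  open Matrices R
  open import Algebra.Properties.Semiring.Sum semiring using (sum; sum-cong-≋; sum-remove; sum-replicate-zero)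
  open import Relation.Binary.Reasoning.Setoid setoid

  ∑≡sum : ∀ {k} (f : Fin k → Carrier) → ∑ f ≡ sum f
  ∑≡sum {ℕ.zero} f = ≡.refl
  ∑≡sum {suc k}  f = ≡.cong (f zero +_) (∑≡sum (f ∘ suc))

  ∑-cong : ∀ {k} {f g : Fin k → Carrier} → (∀ i → f i ≈ g i) → ∑ f ≈ ∑ g
  ∑-cong {f = f} {g} f≈g = begin
    ∑ f    ≡⟨ ∑≡sum f ⟩
    sum f  ≈⟨ sum-cong-≋ f≈g ⟩
    sum g  ≡⟨ ∑≡sum g ⟨
    ∑ g    ∎

  ∑-supported-at : ∀ {k} (f : Fin k → Carrier) a → (∀ i → i ≢ a → f i ≈ 0#) → ∑ f ≈ f a
  ∑-supported-at {suc k} f a f≈0 = begin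
    ∑ f                                      ≡⟨ ∑≡sum f ⟩
    sum f                                    ≈⟨ sum-remove f ⟩
    f a + sum (f ∘ punchIn a)                ≈⟨ +-congˡ (sum-cong-≋ (λ j → f≈0 _ (punchInᵢ≢i a j))) ⟩
    f a + sum (replicate k 0#)               ≈⟨ +-congˡ (sum-replicate-zero k) ⟩
    f a + 0#                                 ≈⟨ +-identityʳ (f a) ⟩
    f a                                      ∎

  ∑-supported-at-two : ∀ {k} (f : Fin k → Carrier) {a b} → a ≢ b →
                       (∀ i → i ≢ a → i ≢ b → f i ≈ 0#) → ∑ f ≈ f a + f b
  ∑-supported-at-two {suc k} f {a} {b} a≢b f≈0 = begin
    ∑ f                                      ≡⟨ ∑≡sum f ⟩
    sum f                                    ≈⟨ sum-remove f ⟩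
    f a + sum (f ∘ punchIn a)                ≡⟨ ≡.cong (f a +_) (∑≡sum (f ∘ punchIn a)) ⟨
    f a + ∑ (f ∘ punchIn a)                  ≈⟨ +-congˡ (∑-supported-at (f ∘ punchIn a) b′ vanishes) ⟩
    f a + f (punchIn a b′)                   ≡⟨ ≡.cong (λ i → f a + f i) (punchIn-punchOut a≢b) ⟩
    f a + f b                                ∎
    where
    b′ = punchOut a≢b
    vanishes : ∀ j → j ≢ b′ → f (punchIn a j) ≈ 0#
    vanishes j j≢b′ = f≈0 _ (punchInᵢ≢i a j) λ eq →
      j≢b′ (punchIn-injective a j b′ (≡.trans eq (≡.sym (punchIn-punchOut a≢b))))

  sumList≡foldr : ∀ {m} (w : Fin m → Carrier) ks → sumList w ks ≡ foldr _+_ 0# (map w ks)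
  sumList≡foldr w []       = ≡.refl
  sumList≡foldr w (k ∷ ks) = ≡.cong (w k +_) (sumList≡foldr w ks)

  sumList-reverse : ∀ {m} (w : Fin m → Carrier) ks → sumList w (reverse ks) ≈ sumList w ks
  sumList-reverse w ks = begin
    sumList w (reverse ks)              ≡⟨ sumList≡foldr w (reverse ks) ⟩
    foldr _+_ 0# (map w (reverse ks))   ≡⟨ ≡.cong (foldr _+_ 0#) (reverse-map w ks) ⟩
    foldr _+_ 0# (reverse (map w ks))   ≈⟨ foldr-commMonoid +-isCommutativeMonoid (↭-reverse (map w ks)) ⟩
    foldr _+_ 0# (map w ks)             ≡⟨ sumList≡foldr w ks ⟨
    sumList w ks                        ∎
    where open Permutation-Properties setoid using (foldr-commMonoid; ↭-reverse)

module EntryIdentity {c ℓ : Level} (R : CommutativeRing c ℓ) {m : ℕ}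
                     (ends : Ends (suc m) m) (T : IsTree ends) (w : Fin m → CommutativeRing.Carrier R) where
  open CommutativeRing R hiding (zero)
  open Matrices R
  open FinSums R
  open MixedDifference R
  open Trees ends T
  open LoopFree ends T
  open import Algebra.Properties.Ring ring using (-1*x≈-x; -‿distribˡ-*; -‿distribʳ-*)
  open import Algebra.Properties.AbelianGroup +-abelianGroup using () renaming (⁻¹-involutive to -‿involutive)
  open import Relation.Binary.Reasoning.Setoid setoid

  edge : ∀ k → Adj ends k (init ends k) (term ends k)
  edge k = inj₁ (≡.refl , ≡.refl)

  D : Fin (suc m) → Fin (suc m) → Carrier
  D = dist ends T w

  Qw : Matrix (suc m) m
  Qw = Q ends T w

  Δw : Matrix (suc m) (suc m)
  Δw = Δ ends T w

  Fw Hw : Matrix m m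
  Fw = F ends T w
  Hw = H ends T w

  edgeMixedΔ : Fin m → Fin m → Carrier
  edgeMixedΔ k l = mixedΔ (D (init ends k) (init ends l)) (D (term ends k) (init ends l))
                          (D (init ends k) (term ends l)) (D (term ends k) (term ends l))

  Q-init : ∀ k → Qw (init ends k) k ≡ 1#
  Q-init k rewrite ≡-≟-identity Fin._≟_ (≡.refl {x = init ends k}) = ≡.refl

  Q-term : ∀ k → Qw (term ends k) k ≡ - 1#
  Q-term k rewrite ≢-≟-identity Fin._≟_ (init≢term k ∘ ≡.sym)
                 | ≡-≟-identity Fin._≟_ (≡.refl {x = term ends k}) = ≡.refl

  Q-elsewhere : ∀ {k i} → i ≢ init ends k → i ≢ term ends k → Qw i k ≡ 0#
  Q-elsewhere i≢p i≢q rewrite ≢-≟-identity Fin._≟_ i≢p | ≢-≟-identity Fin._≟_ i≢q = ≡.refl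

  ∑-Q-column : ∀ k (f : Fin (suc m) → Carrier) →
               ∑ (λ i → Qw i k * f i) ≈ f (init ends k) - f (term ends k)
  ∑-Q-column k f = begin
    ∑ (λ i → Qw i k * f i)        ≈⟨ ∑-supported-at-two _ (init≢term k) vanishes ⟩
    Qw p k * f p + Qw q k * f q   ≡⟨ ≡.cong₂ (λ x y → x * f p + y * f q) (Q-init k) (Q-term k) ⟩
    1# * f p + - 1# * f q         ≈⟨ +-cong (*-identityˡ (f p)) (-1*x≈-x (f q)) ⟩
    f p - f q                     ∎
    where
    p = init ends k
    q = term ends k
    vanishes : ∀ i → i ≢ p → i ≢ q → Qw i k * f i ≈ 0#
    vanishes i i≢p i≢q = trans (*-congʳ (reflexive (Q-elsewhere i≢p i≢q))) (zeroˡ (f i))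

  F-diagonal : ∀ k → Fw k k ≡ w k
  F-diagonal k rewrite ≡-≟-identity Fin._≟_ (≡.refl {x = k}) = ≡.refl

  F-off-diagonal : ∀ {k l} → k ≢ l → Fw k l ≡ 0#
  F-off-diagonal k≢l rewrite ≢-≟-identity Fin._≟_ k≢l = ≡.refl

  ∑-F-row : ∀ k (g : Fin m → Carrier) → ∑ (λ i → Fw k i * g i) ≈ w k * g k
  ∑-F-row k g = trans
    (∑-supported-at _ k λ i i≢k → trans (*-congʳ (reflexive (F-off-diagonal (i≢k ∘ ≡.sym)))) (zeroˡ (g i)))
    (*-congʳ (reflexive (F-diagonal k)))

  ∑-F-column : ∀ l (g : Fin m → Carrier) → ∑ (λ j → g j * Fw j l) ≈ g l * w l
  ∑-F-column l g = trans
    (∑-supported-at _ l λ j j≢l → trans (*-congˡ (reflexive (F-off-diagonal j≢l))) (zeroʳ (g j)))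
    (*-congˡ (reflexive (F-diagonal l)))

  QᵀΔQ-entry : ∀ k l → ((Qw ᵀ) · Δw · Qw) k l ≈ edgeMixedΔ k l
  QᵀΔQ-entry k l = begin
    ∑ (λ j → ∑ (λ i → Qw i k * Δw i j) * Qw j l)
      ≈⟨ ∑-cong (λ j → trans (*-congʳ (∑-Q-column k (λ i → Δw i j))) (*-comm _ (Qw j l))) ⟩
    ∑ (λ j → Qw j l * (Δw (init ends k) j - Δw (term ends k) j))
      ≈⟨ ∑-Q-column l (λ j → Δw (init ends k) j - Δw (term ends k) j) ⟩
    _ ∎

  FHF-entry : ∀ k l → scale (- (1# + 1#)) (Fw · Hw · Fw) k l ≈
                      - (1# + 1#) * ((w k * Hw k l) * w l)
  FHF-entry k l = *-congˡ (begin
    ∑ (λ j → ∑ (λ i → Fw k i * Hw i j) * Fw j l)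
      ≈⟨ ∑-cong (λ j → *-congʳ (∑-F-row k (λ i → Hw i j))) ⟩
    ∑ (λ j → (w k * Hw k j) * Fw j l)
      ≈⟨ ∑-F-column l _ ⟩
    (w k * Hw k l) * w l ∎)

  dist-refl : ∀ u → D u u ≈ 0#
  dist-refl u = reflexive (≡.cong (sumList w) (pathEdges-refl u))

  dist-sym : ∀ u v → D v u ≈ D u v
  dist-sym u v = trans (reflexive (≡.cong (sumList w) (pathEdges-sym u v))) (sumList-reverse w (pathEdges u v))

  dist-edge : ∀ k → D (init ends k) (term ends k) ≈ w k
  dist-edge k = trans (reflexive (≡.cong (sumList w) (pathEdges-edge (edge k) (init≢term k)))) (+-identityʳ (w k))

  dist-crossing : ∀ {k u v x} → Crosses k u v x → D u x ≈ w k + D v x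
  dist-crossing crosses = reflexive (≡.cong (sumList w) crosses)

  dist-crossing′ : ∀ {k u v x} → Crosses k u v x → D x u ≈ w k + D x v
  dist-crossing′ {u = u} {v} {x} crosses =
    trans (dist-sym u x) (trans (dist-crossing crosses) (+-congˡ (sym (dist-sym v x))))

  ρ-crossing : ∀ {k u v x} → Crosses k u v x → ρ ends T u x ≡ suc (ρ ends T v x)
  ρ-crossing = ≡.cong length

  ρ-crossing′ : ∀ {k u v x} → Crosses k u v x → ρ ends T x u ≡ suc (ρ ends T x v)
  ρ-crossing′ {u = u} {v} {x} crosses =
    ≡.trans (ρ-sym u x) (≡.trans (ρ-crossing crosses) (≡.cong suc (≡.sym (ρ-sym v x))))

  H-diagonal : ∀ k → Hw k k ≡ 1#
  H-diagonal k rewrite ≡-≟-identity Fin._≟_ (≡.refl {x = k}) = ≡.refl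

  H-similar : ∀ {k l} → k ≢ l → ρ ends T (init ends k) (init ends l) ≡ ρ ends T (term ends k) (term ends l) →
              Hw k l ≡ 1#
  H-similar k≢l eq rewrite ≢-≟-identity Fin._≟_ k≢l | ≡-≟-identity ℕ._≟_ eq = ≡.refl

  H-opposite : ∀ {k l} → k ≢ l → ρ ends T (init ends k) (init ends l) ≢ ρ ends T (term ends k) (term ends l) →
               Hw k l ≡ - 1#
  H-opposite k≢l neq rewrite ≢-≟-identity Fin._≟_ k≢l | ≢-≟-identity ℕ._≟_ neq = ≡.refl

  double : ∀ t → (1# + 1#) * t ≈ t + t
  double t = trans (distribʳ t 1# 1#) (+-cong (*-identityˡ t) (*-identityˡ t))

  scaled-similar : ∀ {h} a b → h ≡ 1# → - (1# + 1#) * ((a * h) * b) ≈ - (a * b + a * b)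
  scaled-similar a b ≡.refl = begin
    - (1# + 1#) * ((a * 1#) * b)  ≈⟨ *-congˡ (*-congʳ (*-identityʳ a)) ⟩
    - (1# + 1#) * (a * b)         ≈⟨ -‿distribˡ-* (1# + 1#) (a * b) ⟨
    - ((1# + 1#) * (a * b))       ≈⟨ -‿cong (double (a * b)) ⟩
    - (a * b + a * b)             ∎

  scaled-opposite : ∀ {h} a b → h ≡ - 1# → - (1# + 1#) * ((a * h) * b) ≈ a * b + a * b
  scaled-opposite a b ≡.refl = begin
    - (1# + 1#) * ((a * - 1#) * b)  ≈⟨ *-congˡ (*-assoc a (- 1#) b) ⟩
    - (1# + 1#) * (a * (- 1# * b))  ≈⟨ *-congˡ (*-congˡ (-1*x≈-x b)) ⟩
    - (1# + 1#) * (a * - b)         ≈⟨ *-congˡ (-‿distribʳ-* a b) ⟨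
    - (1# + 1#) * - (a * b)         ≈⟨ -‿distribˡ-* (1# + 1#) (- (a * b)) ⟨
    - ((1# + 1#) * - (a * b))       ≈⟨ -‿cong (-‿distribʳ-* (1# + 1#) (a * b)) ⟨
    - - ((1# + 1#) * (a * b))       ≈⟨ -‿involutive _ ⟩
    (1# + 1#) * (a * b)             ≈⟨ double (a * b) ⟩
    a * b + a * b                   ∎

  edgeMixedΔ-diagonal : ∀ k → edgeMixedΔ k k ≈ - (1# + 1#) * ((w k * Hw k k) * w k)
  edgeMixedΔ-diagonal k = trans
    (mixedΔ-diagonal (w k) (dist-refl _) (trans (dist-sym _ _) (dist-edge k)) (dist-edge k) (dist-refl _))
    (sym (scaled-similar (w k) (w k) (H-diagonal k)))

  -- Both ends of e_l lie on one side of e_k, and the side of e_l on which e_k lies decides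
  -- which of the four distances is the largest.
  edgeMixedΔ-off-diagonal : ∀ {k l} → k ≢ l → edgeMixedΔ k l ≈ - (1# + 1#) * ((w k * Hw k l) * w l)
  edgeMixedΔ-off-diagonal {k} {l} k≢l
    with same-side (edge k) (edge l) (init≢term k) k≢l
       | edge-side (edge l) (init≢term l) (term ends k)
       | edge-side (edge l) (init≢term l) (init ends k)
  ... | inj₁ (kr , ks) | inj₁ lq | _ = trans
    (mixedΔ-far-a (w k) (w l) (dist-crossing kr) (dist-crossing′ lq) (dist-crossing ks))
    (sym (scaled-opposite (w k) (w l) (H-opposite k≢l (≡2+⇒≢ ρpr≡2+ρqs))))
    where ρpr≡2+ρqs = ≡.trans (ρ-crossing kr) (≡.cong suc (ρ-crossing′ lq))
  ... | inj₁ (kr , ks) | inj₂ lq | _ = trans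
    (mixedΔ-far-c (w k) (w l) (dist-crossing ks) (dist-crossing′ lq) (dist-crossing kr))
    (sym (scaled-similar (w k) (w l) (H-similar k≢l ρpr≡ρqs)))
    where ρpr≡ρqs = ≡.trans (ρ-crossing kr) (≡.sym (ρ-crossing′ lq))
  ... | inj₂ (kr , ks) | _ | inj₁ lp = trans
    (mixedΔ-far-b (w k) (w l) (dist-crossing kr) (dist-crossing′ lp) (dist-crossing ks))
    (sym (scaled-similar (w k) (w l) (H-similar k≢l ρpr≡ρqs)))
    where ρpr≡ρqs = ≡.trans (ρ-crossing′ lp) (≡.sym (ρ-crossing ks))
  ... | inj₂ (kr , ks) | _ | inj₂ lp = trans
    (mixedΔ-far-d (w k) (w l) (dist-crossing ks) (dist-crossing′ lp) (dist-crossing kr))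
    (sym (scaled-opposite (w k) (w l) (H-opposite k≢l (≡2+⇒≢ ρqs≡2+ρpr ∘ ≡.sym))))
    where ρqs≡2+ρpr = ≡.trans (ρ-crossing ks) (≡.cong suc (ρ-crossing′ lp))

  edgeMixedΔ-identity : ∀ k l → edgeMixedΔ k l ≈ - (1# + 1#) * ((w k * Hw k l) * w l)
  edgeMixedΔ-identity k l = by-cases (k Fin.≟ l)
    where
    by-cases : Dec (k ≡ l) → edgeMixedΔ k l ≈ - (1# + 1#) * ((w k * Hw k l) * w l)
    by-cases (yes ≡.refl) = edgeMixedΔ-diagonal k
    by-cases (no k≢l)     = edgeMixedΔ-off-diagonal k≢l

-- The weights need not be nonzero.
lemma2p3 : ∀ {c ℓ : Level} (R : CommutativeRing c ℓ) (m : ℕ)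
    (ends : Ends (suc m) m) (T : IsTree ends)
    (w : Fin m → CommutativeRing.Carrier R) →
    (∀ k → ¬ (CommutativeRing._≈_ R (w k) (CommutativeRing.0# R))) →
    let open CommutativeRing R
        open Matrices R
    in ∀ k l →
       ((Q ends T w ᵀ) · Δ ends T w · Q ends T w) k l
         ≈ scale (- (1# + 1#)) (F ends T w · H ends T w · F ends T w) k l
lemma2p3 R m ends T w _ k l =
  trans (QᵀΔQ-entry k l) (trans (edgeMixedΔ-identity k l) (sym (FHF-entry k l)))
  where
  open CommutativeRing R
  open EntryIdentity R ends T w
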